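{- Let $\mathbb{F}$ be an infinite field of characteristic $0$ and let $n$ be a positive integer. Then the algebra $(\mathcal{M}_n(\mathbb{F}),\mathbb{F},\times,+_\mathbb{F},|\ast|)$ is not an $\vec{e}$-Ramsey algebra for any nonconstant $\vec{e}\in\Omega_0$.
   Context: An algebra is a pair $(\{A_\xi\}_{\xi\in I},\mathcal{F})$ with nonempty, pairwise disjoint phyla and a family $\mathcal{F}$ of operations, each with domain a finite product of phyla and codomain a phylum. A sort is $\vec{e}\in{}^\omega I$, and $\vec{b}$ is $\vec{e}$-sorted if $\vec{b}(i)\in A_{\vec{e}(i)}$ for all $i$. Orderly terms: $\mathcal{F}_0=\mathcal{F}\cup\{\mathrm{id}_{A_\xi}\}$. $\mathcal{F}_{k+1}$ is $\mathcal{F}_k$ plus all $f$ with $f(\vec{x})=g(h_1(\vec{x}_1),\dots,h_N(\vec{x}_N))$, where $g\in\mathcal{F}$ is $N$-ary, $h_i\in\mathcal{F}_k$, and $\vec{x}_1\ast\cdots\ast\vec{x}_N=\vec{x}$ is the argument list of $f$ (concatenation). $\mathrm{OT}(\mathcal{F})=\bigcup_k\mathcal{F}_k$. $\vec{a}\le_\mathcal{F}\vec{b}$ means: for each $j$ there are a finite subsequence $\vec{b}_j$ of $\vec{b}$ and $f_j\in\mathrm{OT}(\mathcal{F})$ with $\vec{a}(j)=f_j(\vec{b}_j)$, and $\vec{b}_0\ast\vec{b}_1\ast\cdots$ is a subsequence of $\vec{b}$. $\mathrm{FR}^{\vec{e}}_\mathcal{F}(\vec{b})=\{\vec{a}(0):\vec{a}\le_\mathcal{F}\vec{b},\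 \vec{a}\ \vec{e}\text{ -sorted}\}$. $\vec{e}$-Ramsey algebra: for every $\vec{e}$-sorted $\vec{b}$ and $X\subseteq A_{\vec{e}(0)}$ some $\vec{e}$-sorted $\vec{a}\le_\mathcal{F}\vec{b}$ has $\mathrm{FR}^{\vec{e}}_\mathcal{F}(\vec{a})\subseteq X$ or disjoint from $X$. $\Omega$ is the set of sorts each of whose values is taken infinitely often, and $\Omega_0=\{\vec{e}\in\Omega:\vec{e}(0)=0\}$. The phyla are $A_0=\mathbb{F}$ (index $0$) and $A_1=\mathcal{M}_n(\mathbb{F})$ of $n\times n$ matrices over $\mathbb{F}$ (index $1$), regarded as disjoint. The operations here are matrix multiplication $\times$, field addition $+_\mathbb{F}$, and the determinant $|\ast|:\mathcal{M}_n(\mathbb{F})\to\mathbb{F}$. -}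

module Defs where

open import Level using (Level; _⊔_) renaming (suc to lsuc)
open import Algebra.Bundles using (CommutativeRing)
open import Data.Nat as ℕ using (ℕ; zero; suc; _<_; _≤_)
open import Data.Fin using (Fin; zero; suc; punchIn)
open import Data.List using (List; []; _∷_; _++_; map)
open import Data.List.Membership.Propositional using (_∈_)
open import Data.List.Relation.Unary.Linked using (Linked)
open import Data.Product using (Σ; _×_; _,_; ∃; ∃-syntax)
open import Data.Sum using (_⊎_)
open import Data.Unit.Polymorphic using (⊤)
open import Relation.Nullary using (¬_)
open import Relation.Binary.PropositionalEquality using (_≡_; _≢_)

record Field (c ℓ : Level) : Set (lsuc (c ⊔ ℓ)) where
  field
    commutativeRing : CommutativeRing c ℓ
  open CommutativeRing commutativeRing public
  field
    1≉0     : ¬ (1# ≈ 0#)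
    inverse : ∀ x → ¬ (x ≈ 0#) → ∃[ y ] (x * y ≈ 1#)

module FieldTheory {c ℓ : Level} (F : Field c ℓ) where
  open Field F using (Carrier; _≈_; _+_; _*_; -_; 0#; 1#)

  ℕ·1 : ℕ → Carrier
  ℕ·1 zero    = 0#
  ℕ·1 (suc m) = 1# + ℕ·1 m

  Char0 : Set ℓ
  Char0 = ∀ m → ¬ (ℕ·1 (suc m) ≈ 0#)

  Infinite : Set (c ⊔ ℓ)
  Infinite = ∀ (xs : List Carrier) → ∃[ y ] (∀ x → x ∈ xs → ¬ (y ≈ x))

  Mat : ℕ → Set c
  Mat n = Fin n → Fin n → Carrier

  _≈M_ : ∀ {n} → Mat n → Mat n → Set ℓ
  A ≈M B = ∀ i j → A i j ≈ B i j

  Σᶠ : ∀ {k} → (Fin k → Carrier) → Carrier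
  Σᶠ {zero}  f = 0#
  Σᶠ {suc k} f = f zero + Σᶠ (λ i → f (suc i))

  altΣ : ∀ {k} → (Fin k → Carrier) → Carrier
  altΣ {zero}  f = 0#
  altΣ {suc k} f = f zero + - altΣ (λ i → f (suc i))

  _×M_ : ∀ {n} → Mat n → Mat n → Mat n
  (A ×M B) i k = Σᶠ (λ j → A i j * B j k)

  det : ∀ {n} → Mat n → Carrier
  det {zero}  A = 1#
  det {suc n} A = altΣ (λ j → A zero j * det (λ r s → A (suc r) (punchIn j s)))

  -- The two-sorted algebra (M_n(F), F, ×, +_F, |·|); phylum 0 is F,
  -- phylum 1 is M_n(F).

  Sort : Set
  Sort = Fin 2

  module Alg (n : ℕ) where

    Phylum : Sort → Set c
    Phylum zero       = Carrier
    Phylum (suc zero) = Mat n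

    _≈ₚ_ : ∀ {ξ} → Phylum ξ → Phylum ξ → Set ℓ
    _≈ₚ_ {zero}       x y = x ≈ y
    _≈ₚ_ {suc zero}   x y = x ≈M y

    -- OT-id is id_{A_ξ}; the other constructors are g(h₁(x⃗₁),…,h_N(x⃗_N))
    -- for g ∈ {×, +_F, |·|} with argument list x⃗₁ ∗ ⋯ ∗ x⃗_N.
    data OT : List Sort → Sort → Set where
      OT-id  : ∀ ξ → OT (ξ ∷ []) ξ
      OT-mul : ∀ {xs ys} → OT xs (suc zero) → OT ys (suc zero) → OT (xs ++ ys) (suc zero)
      OT-add : ∀ {xs ys} → OT xs zero → OT ys zero → OT (xs ++ ys) zero
      OT-det : ∀ {xs} → OT xs (suc zero) → OT xs zero

    Args : List Sort → Set c
    Args []       = ⊤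
    Args (ξ ∷ ξs) = Phylum ξ × Args ξs

    split : ∀ xs {ys} → Args (xs ++ ys) → Args xs × Args ys
    split []       as       = _ , as
    split (x ∷ xs) (a , as) with split xs as
    ... | (l , r) = (a , l) , r

    eval : ∀ {xs ξ} → OT xs ξ → Args xs → Phylum ξ
    eval (OT-id ξ) (a , _) = a
    eval (OT-mul {xs} f g) as with split xs as
    ... | (l , r) = eval f l ×M eval g r
    eval (OT-add {xs} f g) as with split xs as
    ... | (l , r) = eval f l + eval g r
    eval (OT-det f) as = det (eval f as)

    module Sorted (e : ℕ → Sort) where

      Seq : Set c
      Seq = (i : ℕ) → Phylum (e i)

      pick : Seq → (is : List ℕ) → Args (map e is)
      pick b []       = _
      pick b (i ∷ is) = b i , pick b is

      _≤F_ : Seq → Seq → Set ℓ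
      a ≤F b =
        Σ (ℕ → List ℕ) λ I →
          (∀ j → Linked _<_ (I j)) ×
          (∀ j k → j < k → ∀ x y → x ∈ I j → y ∈ I k → x < y) ×
          (∀ j → Σ (OT (map e (I j)) (e j)) λ f → _≈ₚ_ {e j} (a j) (eval f (pick b (I j))))

      FR⊆ : Seq → (Phylum (e 0) → Set (c ⊔ ℓ)) → Set (c ⊔ ℓ)
      FR⊆ a X = ∀ a′ → a′ ≤F a → X (a′ 0)

      FR∩∅ : Seq → (Phylum (e 0) → Set (c ⊔ ℓ)) → Set (c ⊔ ℓ)
      FR∩∅ a X = ∀ a′ → a′ ≤F a → ¬ X (a′ 0)

      Respects : (Phylum (e 0) → Set (c ⊔ ℓ)) → Set (c ⊔ ℓ)
      Respects X = ∀ x y → _≈ₚ_ {e 0} x y → X x → X y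

      IsRamsey : Set (lsuc (c ⊔ ℓ))
      IsRamsey = ∀ (b : Seq) (X : Phylum (e 0) → Set (c ⊔ ℓ)) → Respects X →
                 ∃[ a ] (a ≤F b × (FR⊆ a X ⊎ FR∩∅ a X))

Ω : (ℕ → Fin 2) → Set
Ω e = ∀ ξ m → ∃[ k ] (m ≤ k × e k ≡ ξ)

Ω₀ : (ℕ → Fin 2) → Set
Ω₀ e = Ω e × e 0 ≡ zero

Nonconstant : (ℕ → Fin 2) → Set
Nonconstant e = ∃[ i ] ∃[ j ] (e i ≢ e j)

module Submission where

-- Start from the sequence b of units (1 in every scalar slot, the
-- identity matrix I in every matrix slot).  Call a scalar tame if it is
-- m·1 for some m ∈ ℕ and a matrix tame if it equals I.  Tame values are
-- closed under ×, +_F and |·| (I·I = I, |I| = 1, m·1 + k·1 = (m+k)·1), so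
-- every reduct a ≤_F b is tame everywhere.  Colour F by X = {m·1 : m even},
-- which is well defined because m ↦ m·1 is injective in characteristic 0.
-- Given a ≤_F b, pick a matrix position p ≥ 1 of a.  Both a(0) and
-- a(0) + |a(p)| = a(0) + 1 occur as FR-values of a (completed by the same
-- tail of a, chosen via Ω), and exactly one of them lies in X; so FR(a) is
-- neither inside X nor disjoint from X.

open import Defs
open import Level using (Level; _⊔_; Lift; lift)
open import Data.Nat using (ℕ; zero; suc; parity; _≤_; _<_; z≤n; s≤s) renaming (_+_ to _+ℕ_)
open import Data.Nat.Properties using (<-trans; ≤-refl; ≤-<-trans; m≤n⇒m<n∨m≡n)
open import Data.Parity.Base using (0ℙ; 1ℙ; _⁻¹)
open import Data.Parity.Properties using (suc-homo-⁻¹)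
open import Data.Fin using (Fin; zero; suc; punchIn)
open import Data.List using (List; []; _∷_; _++_; map)
open import Data.List.Membership.Propositional using (_∈_)
open import Data.List.Relation.Unary.Any using (here; there)
open import Data.List.Relation.Unary.Linked using (Linked; [-]; _∷_)
open import Data.Product using (Σ; _×_; _,_; proj₁; proj₂; ∃-syntax)
open import Data.Sum using (_⊎_; inj₁; inj₂; [_,_]′)
open import Data.Empty using (⊥)
open import Data.Unit.Polymorphic using (⊤; tt)
open import Relation.Nullary using (¬_)
open import Relation.Binary.PropositionalEquality as ≡ using (_≡_; refl; cong)

module Proof {c ℓ : Level} (F : Field c ℓ) where
  open Field F hiding (zero) renaming (refl to ≈-refl; sym to ≈-sym; trans to ≈-trans)
  open FieldTheory F
  open import Algebra.Properties.Ring ring using (-0#≈0#; +-cancelˡ)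
  open import Relation.Binary.Reasoning.Setoid setoid

  Σᶠ-cong : ∀ {k} {f g : Fin k → Carrier} → (∀ i → f i ≈ g i) → Σᶠ f ≈ Σᶠ g
  Σᶠ-cong {zero}  f≈g = ≈-refl
  Σᶠ-cong {suc k} f≈g = +-cong (f≈g zero) (Σᶠ-cong (λ i → f≈g (suc i)))

  Σᶠ-zero : ∀ {k} (f : Fin k → Carrier) → (∀ i → f i ≈ 0#) → Σᶠ f ≈ 0#
  Σᶠ-zero {zero}  f f≈0 = ≈-refl
  Σᶠ-zero {suc k} f f≈0 = ≈-trans (+-cong (f≈0 zero) (Σᶠ-zero _ (λ i → f≈0 (suc i)))) (+-identityʳ 0#)

  altΣ-zero : ∀ {k} (f : Fin k → Carrier) → (∀ i → f i ≈ 0#) → altΣ f ≈ 0#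
  altΣ-zero {zero}  f f≈0 = ≈-refl
  altΣ-zero {suc k} f f≈0 = begin
    f zero + - altΣ (λ i → f (suc i)) ≈⟨ +-cong (f≈0 zero) (-‿cong (altΣ-zero _ (λ i → f≈0 (suc i)))) ⟩
    0# + - 0#                         ≈⟨ +-identityˡ (- 0#) ⟩
    - 0#                              ≈⟨ -0#≈0# ⟩
    0#                                ∎

  idM : ∀ {n} → Mat n
  idM zero    zero    = 1#
  idM zero    (suc j) = 0#
  idM (suc i) zero    = 0#
  idM (suc i) (suc j) = idM i j

  Σᶠ-idM : ∀ {n} (i : Fin n) (f : Fin n → Carrier) → Σᶠ (λ j → idM i j * f j) ≈ f i
  Σᶠ-idM zero f = begin
    1# * f zero + Σᶠ (λ j → 0# * f (suc j)) ≈⟨ +-cong (*-identityˡ _) (Σᶠ-zero _ (λ j → zeroˡ (f (suc j)))) ⟩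
    f zero + 0#                             ≈⟨ +-identityʳ _ ⟩
    f zero                                  ∎
  Σᶠ-idM (suc i) f = begin
    0# * f zero + Σᶠ (λ j → idM i j * f (suc j)) ≈⟨ +-cong (zeroˡ _) (Σᶠ-idM i (λ j → f (suc j))) ⟩
    0# + f (suc i)                               ≈⟨ +-identityˡ _ ⟩
    f (suc i)                                    ∎

  ×M-idM : ∀ {n} {A B : Mat n} → A ≈M idM → B ≈M idM → (A ×M B) ≈M idM
  ×M-idM A≈I B≈I i k =
    ≈-trans (Σᶠ-cong (λ j → *-cong (A≈I i j) (B≈I j k))) (Σᶠ-idM i (λ j → idM j k))

  -- Laplace expansion along the first row: only the (0,0) cofactor survives,
  -- and its minor is again the identity.
  det-idM : ∀ {n} {A : Mat n} → A ≈M idM → det A ≈ 1#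
  det-idM {zero}  A≈I = ≈-refl
  det-idM {suc n} {A} A≈I = begin
    A zero zero * det (minor zero) + - altΣ (λ j → A zero (suc j) * det (minor (suc j)))
      ≈⟨ +-cong (*-cong (A≈I zero zero) (det-idM (λ r s → A≈I (suc r) (suc s))))
                (-‿cong (altΣ-zero _ (λ j → ≈-trans (*-cong (A≈I zero (suc j)) ≈-refl) (zeroˡ _)))) ⟩
    1# * 1# + - 0#
      ≈⟨ +-cong (*-identityˡ 1#) -0#≈0# ⟩
    1# + 0#
      ≈⟨ +-identityʳ 1# ⟩
    1#
      ∎
    where
    minor : Fin (suc n) → Mat n
    minor j r s = A (suc r) (punchIn j s)

  ℕ·1-+ : ∀ m k → ℕ·1 (m +ℕ k) ≈ ℕ·1 m + ℕ·1 k
  ℕ·1-+ zero    k = ≈-sym (+-identityˡ _)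
  ℕ·1-+ (suc m) k = ≈-trans (+-cong ≈-refl (ℕ·1-+ m k)) (≈-sym (+-assoc 1# (ℕ·1 m) (ℕ·1 k)))

  ℕ·1-suc : ∀ {x} m → x ≈ ℕ·1 m → x + 1# ≈ ℕ·1 (suc m)
  ℕ·1-suc m x≈m = ≈-trans (+-comm _ 1#) (+-cong ≈-refl x≈m)

  ℕ·1-injective : Char0 → ∀ m k → ℕ·1 m ≈ ℕ·1 k → m ≡ k
  ℕ·1-injective char0 zero    zero    _ = refl
  ℕ·1-injective char0 zero    (suc k) h with () ← char0 k (≈-sym h)
  ℕ·1-injective char0 (suc m) zero    h with () ← char0 m h
  ℕ·1-injective char0 (suc m) (suc k) h = cong suc (ℕ·1-injective char0 m k (+-cancelˡ 1# _ _ h))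

  Even : Carrier → Set ℓ
  Even x = ∃[ m ] (x ≈ ℕ·1 m × parity m ≡ 0ℙ)

  Even-resp : ∀ {x y} → x ≈ y → Even x → Even y
  Even-resp x≈y (m , x≈m , even) = m , ≈-trans (≈-sym x≈y) x≈m , even

  even-or-even-succ : ∀ {x} m → x ≈ ℕ·1 m → Even x ⊎ Even (x + 1#)
  even-or-even-succ m x≈m with parity m in eq
  ... | 0ℙ = inj₁ (m , x≈m , eq)
  ... | 1ℙ = inj₂ (suc m , ℕ·1-suc m x≈m , ≡.trans (≡.sym (suc-homo-⁻¹ (suc m))) (cong _⁻¹ eq))

  -- Uses characteristic 0: x + 1 = (m+1)·1 has the parity opposite to m.
  not-even-and-even-succ : Char0 → ∀ {x} → Even x → Even (x + 1#) → ⊥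
  not-even-and-even-succ char0 (m , x≈m , even) (k , x+1≈k , even′)
    with refl ← ℕ·1-injective char0 (suc m) k (≈-trans (≈-sym (ℕ·1-suc m x≈m)) x+1≈k)
    with () ← ≡.trans (≡.sym (cong _⁻¹ even′)) (≡.trans (suc-homo-⁻¹ m) even)

  module TwoSorted (n : ℕ) where
    open Alg n

    ≈ₚ-refl : ∀ ξ (x : Phylum ξ) → _≈ₚ_ {ξ} x x
    ≈ₚ-refl zero       x = ≈-refl
    ≈ₚ-refl (suc zero) x = λ i j → ≈-refl

    Tame : ∀ ξ → Phylum ξ → Set ℓ
    Tame zero       x = ∃[ m ] (x ≈ ℕ·1 m)
    Tame (suc zero) A = A ≈M idM

    Tame-resp : ∀ ξ {x y : Phylum ξ} → _≈ₚ_ {ξ} x y → Tame ξ y → Tame ξ x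
    Tame-resp zero       x≈y (m , y≈m) = m , ≈-trans x≈y y≈m
    Tame-resp (suc zero) x≈y y≈I       = λ i j → ≈-trans (x≈y i j) (y≈I i j)

    AllTame : ∀ ξs → Args ξs → Set ℓ
    AllTame []       _        = ⊤
    AllTame (ξ ∷ ξs) (a , as) = Tame ξ a × AllTame ξs as

    split-tame : ∀ ξs {ζs} (as : Args (ξs ++ ζs)) → AllTame (ξs ++ ζs) as →
                 AllTame ξs (proj₁ (split ξs as)) × AllTame ζs (proj₂ (split ξs as))
    split-tame []       as       t          = tt , t
    split-tame (ξ ∷ ξs) (a , as) (ta , tas) with split ξs as | split-tame ξs as tas
    ... | _ , _ | tl , tr = (ta , tl) , tr

    eval-tame : ∀ {ξs ξ} (f : OT ξs ξ) (as : Args ξs) → AllTame ξs as → Tame ξ (eval f as)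
    eval-tame (OT-id ξ) (a , _) (ta , _) = ta
    eval-tame (OT-mul {ξs} f g) as t with split ξs as | split-tame ξs as t
    ... | l , r | tl , tr = ×M-idM (eval-tame f l tl) (eval-tame g r tr)
    eval-tame (OT-add {ξs} f g) as t with split ξs as | split-tame ξs as t
    ... | l , r | tl , tr with eval-tame f l tl | eval-tame g r tr
    ... | m , fl≈m | k , gr≈k = m +ℕ k , ≈-trans (+-cong fl≈m gr≈k) (≈-sym (ℕ·1-+ m k))
    eval-tame (OT-det f) as t = 1 , ≈-trans (det-idM (eval-tame f as t)) (≈-sym (+-identityʳ 1#))

    module Sequences (e : ℕ → Sort) where
      open Sorted e

      unit : ∀ ξ → Phylum ξ
      unit zero       = 1#
      unit (suc zero) = idM

      unit-tame : ∀ ξ → Tame ξ (unit ξ)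
      unit-tame zero       = 1 , ≈-sym (+-identityʳ 1#)
      unit-tame (suc zero) = λ i j → ≈-refl

      units : Seq
      units i = unit (e i)

      ≤F-tame : ∀ b → (∀ i → Tame (e i) (b i)) → ∀ a → a ≤F b → ∀ j → Tame (e j) (a j)
      ≤F-tame b b-tame a (I , _ , _ , terms) j =
        Tame-resp (e j) (proj₂ (terms j)) (eval-tame (proj₁ (terms j)) (pick b (I j)) (pick-tame (I j)))
        where
        pick-tame : ∀ is → AllTame (map e is) (pick b is)
        pick-tame []       = tt
        pick-tame (i ∷ is) = b-tame i , pick-tame is

      retype : ∀ {ξ ζ} → ζ ≡ ξ → OT (ζ ∷ []) ξ
      retype {ξ} refl = OT-id ξ

      module Selection (Ωe : Ω e) (p : ℕ) where
        pos : ℕ → ℕ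
        pos zero    = p
        pos (suc j) = proj₁ (Ωe (e (suc j)) (suc (pos j)))

        pos-step : ∀ j → pos j < pos (suc j)
        pos-step j = proj₁ (proj₂ (Ωe (e (suc j)) (suc (pos j))))

        pos-sort : ∀ j → e (pos (suc j)) ≡ e (suc j)
        pos-sort j = proj₂ (proj₂ (Ωe (e (suc j)) (suc (pos j))))

        pos-mono : ∀ {j k} → j < k → pos j < pos k
        pos-mono {j} {suc k} (s≤s j≤k) with m≤n⇒m<n∨m≡n j≤k
        ... | inj₁ j<k  = <-trans (pos-mono j<k) (pos-step k)
        ... | inj₂ refl = pos-step j

        prefixed : Seq → Phylum (e 0) → Seq
        prefixed a v zero    = v
        prefixed a v (suc j) = eval (retype (pos-sort j)) (a (pos (suc j)) , tt)

        prefixed-≤F : ∀ a (I₀ : List ℕ) → Linked _<_ I₀ → (∀ x → x ∈ I₀ → x ≤ p) →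
                      (t : OT (map e I₀) (e 0)) → prefixed a (eval t (pick a I₀)) ≤F a
        prefixed-≤F a I₀ I₀-sorted I₀≤p t = I , I-sorted , I-ordered , terms
          where
          I : ℕ → List ℕ
          I zero    = I₀
          I (suc j) = pos (suc j) ∷ []

          I-sorted : ∀ j → Linked _<_ (I j)
          I-sorted zero    = I₀-sorted
          I-sorted (suc j) = [-]

          I-ordered : ∀ j k → j < k → ∀ x y → x ∈ I j → y ∈ I k → x < y
          I-ordered zero    (suc k) _   x y x∈I₀       (here refl) = ≤-<-trans (I₀≤p x x∈I₀) (pos-mono (s≤s z≤n))
          I-ordered (suc j) (suc k) j<k x y (here refl) (here refl) = pos-mono j<k

          terms : ∀ j → Σ (OT (map e (I j)) (e j)) λ f →
                    _≈ₚ_ {e j} (prefixed a (eval t (pick a I₀)) j) (eval f (pick a (I j)))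
          terms zero    = t , ≈ₚ-refl (e 0) _
          terms (suc j) = retype (pos-sort j) , ≈ₚ-refl (e (suc j)) _

    EvenAt : ∀ ξ → Phylum ξ → Set (c ⊔ ℓ)
    EvenAt zero       x = Lift c (Even x)
    EvenAt (suc zero) _ = Lift (c ⊔ ℓ) ⊥

    EvenAt-resp : ∀ ξ {x y : Phylum ξ} → _≈ₚ_ {ξ} x y → EvenAt ξ x → EvenAt ξ y
    EvenAt-resp zero       x≈y (lift even) = lift (Even-resp x≈y even)
    EvenAt-resp (suc zero) _   (lift ())

    plusDet : ∀ {ξ ζ} → ξ ≡ zero → ζ ≡ suc zero → OT (ξ ∷ ζ ∷ []) ξ
    plusDet refl refl = OT-add (OT-id zero) (OT-det (OT-id (suc zero)))

    plusDet-parity : Char0 → ∀ {ξ ζ} (ξ≡0 : ξ ≡ zero) (ζ≡1 : ζ ≡ suc zero) x Y → Tame ξ x → Tame ζ Y →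
                     let s = eval (plusDet ξ≡0 ζ≡1) (x , Y , tt)
                     in (EvenAt ξ x ⊎ EvenAt ξ s) × ¬ (EvenAt ξ x × EvenAt ξ s)
    plusDet-parity char0 refl refl x Y (m , x≈m) Y≈I = one-even , not-both
      where
      x+1≈s : x + 1# ≈ x + det Y
      x+1≈s = +-cong ≈-refl (≈-sym (det-idM Y≈I))

      one-even : Lift c (Even x) ⊎ Lift c (Even (x + det Y))
      one-even = [ (λ ev → inj₁ (lift ev)) , (λ ev → inj₂ (lift (Even-resp x+1≈s ev))) ]′ (even-or-even-succ m x≈m)

      not-both : ¬ (Lift c (Even x) × Lift c (Even (x + det Y)))
      not-both (lift ev , lift ev′) = not-even-and-even-succ char0 ev (Even-resp (≈-sym x+1≈s) ev′)

    module _ (char0 : Char0) (e : ℕ → Sort) (Ωe : Ω e) (e0 : e 0 ≡ zero) where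
      open Sorted e
      open Sequences e

      p : ℕ
      p = proj₁ (Ωe (suc zero) 1)

      1≤p : 1 ≤ p
      1≤p = proj₁ (proj₂ (Ωe (suc zero) 1))

      ep : e p ≡ suc zero
      ep = proj₂ (proj₂ (Ωe (suc zero) 1))

      open Selection Ωe p

      -- Any reduct a of the units has both a(0) and s = a(0) + |a(p)| in its
      -- FR set, and exactly one of them is even.
      notRamsey : ¬ IsRamsey
      notRamsey ramsey with ramsey units (EvenAt (e 0)) (λ _ _ → EvenAt-resp (e 0))
      ... | a , a≤units , homogeneous =
        [ (λ inX → proj₂ exactly-one (inX a′ a′≤a , inX a″ a″≤a))
        , (λ outX → [ outX a′ a′≤a , outX a″ a″≤a ]′ (proj₁ exactly-one)) ]′ homogeneous
        where
        tame : ∀ j → Tame (e j) (a j)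
        tame = ≤F-tame units (λ i → unit-tame (e i)) a a≤units

        s : Phylum (e 0)
        s = eval (plusDet e0 ep) (a 0 , a p , tt)

        exactly-one : (EvenAt (e 0) (a 0) ⊎ EvenAt (e 0) s) × ¬ (EvenAt (e 0) (a 0) × EvenAt (e 0) s)
        exactly-one = plusDet-parity char0 e0 ep (a 0) (a p) (tame 0) (tame p)

        a′ a″ : Seq
        a′ = prefixed a (a 0)
        a″ = prefixed a s

        a′≤a : a′ ≤F a
        a′≤a = prefixed-≤F a (0 ∷ []) [-] (λ { _ (here refl) → z≤n }) (OT-id (e 0))

        a″≤a : a″ ≤F a
        a″≤a = prefixed-≤F a (0 ∷ p ∷ []) (1≤p ∷ [-])
                 (λ { _ (here refl) → z≤n ; _ (there (here refl)) → ≤-refl }) (plusDet e0 ep)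

mainTheorem14 : ∀ {c ℓ : Level} (F : Field c ℓ) → FieldTheory.Infinite F → FieldTheory.Char0 F →
    (n : ℕ) → 1 ≤ n → (e : ℕ → Fin 2) → Ω₀ e → Nonconstant e →
    ¬ FieldTheory.Alg.Sorted.IsRamsey F n e
mainTheorem14 F _ char0 n _ e (Ωe , e0) _ = Proof.TwoSorted.notRamsey F n char0 e Ωe e0
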